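{- Let $\mathcal B$ be a building set on a finite set $V$, and let $\mathcal N,\mathcal N'$ be inclusion-maximal $\mathcal B$-nested sets with $\mathcal N\setminus\{B\}=\mathcal N'\setminus\{B'\}$, $B\ne B'$, and parent $P$. Then every block of $\kappa(B\cap B')$ and every block of $\kappa(P\setminus(B\cup B'))$ belongs to $\mathcal N\cap\mathcal N'$.
   Context: A building set on $V$ is a set $\mathcal B$ of non-empty subsets of $V$ containing all singletons such that $B\cap B'\ne\varnothing$ implies $B\cup B'\in\mathcal B$; $\kappa(\mathcal B)$ is its set of inclusion-maximal blocks, and for $U\subseteq V$, $\kappa(U)$ is the set of inclusion-maximal blocks of $\{C\in\mathcal B:C\subseteq U\}$. A $\mathcal B$-nested set is $\mathcal N\subseteq\mathcal B$ whose members are pairwise nested or disjoint, such that no union of $k\ge2$ pairwise disjoint members is in $\mathcal B$, and with $\kappa(\mathcal B)\subseteq\mathcal N$. For $\mathcal N,\mathcal N'$ as in the claim, the set $\{C\in\mathcal N:B\subsetneq C\}=\{C\in\mathcal N':B'\subsetneq C\}$ has a unique inclusion-minimal element, called the parent. -}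

module Defs where

open import Data.Nat using (ℕ; _≥_)
open import Data.Fin using (Fin)
open import Data.Fin.Subset using (Subset; _⊆_; _⊂_; _∩_; _∪_; ⋃; ⁅_⁆; Nonempty; Empty)
open import Data.List using (List; length)
open import Data.List.Relation.Unary.All using (All)
open import Data.List.Relation.Unary.AllPairs using (AllPairs)
open import Data.Product using (_×_)
open import Data.Sum using (_⊎_)
open import Relation.Nullary using (¬_)
open import Relation.Binary.PropositionalEquality using (_≡_; _≢_)

Family : ℕ → Set₁
Family n = Subset n → Set

record IsBuildingSet {n : ℕ} (ℬ : Family n) : Set where
  field
    nonempty   : ∀ B → ℬ B → Nonempty B
    singletons : ∀ (i : Fin n) → ℬ ⁅ i ⁆
    union      : ∀ B B′ → ℬ B → ℬ B′ → Nonempty (B ∩ B′) → ℬ (B ∪ B′)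

IsMaxBlock : ∀ {n} → Family n → Subset n → Set
IsMaxBlock ℬ C = ℬ C × (∀ D → ℬ D → C ⊆ D → D ≡ C)

Inκ : ∀ {n} → Family n → Subset n → Subset n → Set
Inκ ℬ U C = ℬ C × C ⊆ U × (∀ D → ℬ D → D ⊆ U → C ⊆ D → D ≡ C)

Disjoint : ∀ {n} → Subset n → Subset n → Set
Disjoint C D = Empty (C ∩ D)

record IsNested {n : ℕ} (ℬ : Family n) (𝒩 : Family n) : Set where
  field
    sub       : ∀ C → 𝒩 C → ℬ C
    laminar   : ∀ C D → 𝒩 C → 𝒩 D → (C ⊆ D ⊎ D ⊆ C) ⊎ Disjoint C D
    noUnion   : ∀ (Cs : List (Subset n)) → length Cs ≥ 2 → All 𝒩 Cs →
                AllPairs Disjoint Cs → ¬ ℬ (⋃ Cs)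
    maxBlocks : ∀ C → IsMaxBlock ℬ C → 𝒩 C

record IsMaximalNested {n : ℕ} (ℬ : Family n) (𝒩 : Family n) : Set₁ where
  field
    nested  : IsNested ℬ 𝒩
    maximal : ∀ (𝒩′ : Family n) → IsNested ℬ 𝒩′ → (∀ C → 𝒩 C → 𝒩′ C) →
              ∀ C → 𝒩′ C → 𝒩 C

{-# OPTIONS --safe #-}
-- Membership in a maximal nested set 𝒩 is tested by adding the candidate block C and checking
-- that 𝒩 ∪ {C} is still nested. For C ∈ κ(B ∩ B′) every member of 𝒩 other than B lies in 𝒩′,
-- so it sits inside, around or apart from C relative to B or to B′, and blocks glued to C are
-- absorbed by both B and B′, hence by C. For C ∈ κ(P ─ (B ∪ B′)) take a point r of P lying in
-- no proper member of 𝒩 below P; it exists because P is not a disjoint union of such members.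
-- Then r ∈ B ∪ B′: otherwise B and B′ would both be maximal blocks of P - r, and B′ could be
-- added to 𝒩. Hence r ∉ C, and the maximal block of P - r containing C is a member of 𝒩 and 𝒩′
-- that avoids B and B′, so it is C itself. The existence statements are only established up
-- to double negation, which suffices since membership in a maximal nested set is ¬¬-stable.
module Submission where

open import Defs
open import Data.Nat using (ℕ; suc; _∸_; _≤_; _<_; _≥_; s≤s; z≤n)
open import Data.Nat.Properties using (∸-monoʳ-<; ≤-pred)
open import Data.Nat.Induction using (<-wellFounded)
open import Induction.WellFounded using (Acc; acc)
open import Data.Bool using () renaming (_≟_ to _≟ᵇ_)
open import Data.Fin using (Fin)
open import Data.Fin.Subset
  using (Subset; _⊆_; _⊂_; _⊄_; _∩_; _∪_; _─_; _-_; ⋃; Nonempty; _∈_; _∉_; ∣_∣; inside)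
  renaming (⊥ to ∅)
open import Data.Fin.Subset.Properties
  using ( x∈p∪q⁻; p⊆p∪q; q⊆p∪q; x∈p∩q⁺; x∈p∩q⁻; p─q⊆p; x∈p∧x∉q⇒x∈p─q; x∈p∧x≢y⇒x∈p-y
        ; x∈⁅x⁆; ∉⊥; _∈?_; _⊆?_; _⊂?_; nonempty?; ⊆-refl; ⊆-trans; ⊆-antisym; ⊂-irref
        ; p⊂q⇒∣p∣<∣q∣; ∣p∣≤n; p∩q⊆p; p∩q⊆q; ∪-assoc; ∪-comm; ∪-identityʳ; ∩-comm)
open import Data.Vec as Vec using (here; there)
open import Data.Vec.Properties using (≡-dec)
open import Data.List using (List; []; _∷_; length; filter)
open import Data.List.Relation.Unary.All as All using (All; []; _∷_)
import Data.List.Relation.Unary.All.Properties as All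
open import Data.List.Relation.Unary.AllPairs using (AllPairs; []; _∷_)
import Data.List.Relation.Unary.AllPairs.Properties as AllPairs
open import Data.Product using (∃; _×_; _,_; proj₁; proj₂)
open import Data.Sum using (_⊎_; inj₁; inj₂; [_,_]′)
open import Data.Empty using (⊥; ⊥-elim)
open import Function using (_∘_; id)
open import Relation.Nullary using (¬_; Dec; yes; no; ¬?)
open import Relation.Unary using (Decidable)
open import Relation.Nullary.Decidable using (decidable-stable; _⊎-dec_)
open import Relation.Binary.Definitions using (DecidableEquality)
open import Relation.Binary.PropositionalEquality
  using (_≡_; _≢_; refl; sym; trans; cong; subst; ≢-sym; module ≡-Reasoning)

module _ {n : ℕ} where

  _≟_ : DecidableEquality (Subset n)
  _≟_ = ≡-dec _≟ᵇ_

  ∪-least : ∀ {p q r : Subset n} → p ⊆ r → q ⊆ r → p ∪ q ⊆ r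
  ∪-least {p} {q} p⊆r q⊆r x∈p∪q = [ p⊆r , q⊆r ]′ (x∈p∪q⁻ p q x∈p∪q)

  ∪-absorbʳ : ∀ {p q : Subset n} → q ⊆ p → p ∪ q ≡ p
  ∪-absorbʳ {p} q⊆p = ⊆-antisym (∪-least ⊆-refl q⊆p) (p⊆p∪q _)

  ∪-absorbʳ-∪ : ∀ {p q r : Subset n} → q ⊆ p → p ∪ (q ∪ r) ≡ p ∪ r
  ∪-absorbʳ-∪ {p} {q} {r} q⊆p = trans (sym (∪-assoc p q r)) (cong (_∪ r) (∪-absorbʳ q⊆p))

  ∪-swap : ∀ (p q r : Subset n) → p ∪ (q ∪ r) ≡ q ∪ (p ∪ r)
  ∪-swap p q r = begin
    p ∪ (q ∪ r)  ≡⟨ sym (∪-assoc p q r) ⟩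
    (p ∪ q) ∪ r  ≡⟨ cong (_∪ r) (∪-comm p q) ⟩
    (q ∪ p) ∪ r  ≡⟨ ∪-assoc q p r ⟩
    q ∪ (p ∪ r)  ∎
    where open ≡-Reasoning

  ⊆∩⁺ : ∀ {p q r : Subset n} → p ⊆ q → p ⊆ r → p ⊆ q ∩ r
  ⊆∩⁺ p⊆q p⊆r x∈p = x∈p∩q⁺ (p⊆q x∈p , p⊆r x∈p)

  ⊆∧⊄⇒⊇ : ∀ {p q : Subset n} → p ⊆ q → p ⊄ q → q ⊆ p
  ⊆∧⊄⇒⊇ {p} p⊆q p⊄q {x} x∈q with x ∈? p
  ... | yes x∈p = x∈p
  ... | no  x∉p = ⊥-elim (p⊄q (p⊆q , x , x∈q , x∉p))

  ⊆∧≢⇒⊂ : ∀ {p q : Subset n} → p ⊆ q → q ≢ p → p ⊂ q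
  ⊆∧≢⇒⊂ {p} {q} p⊆q q≢p with p ⊂? q
  ... | yes p⊂q = p⊂q
  ... | no  p⊄q = ⊥-elim (q≢p (⊆-antisym (⊆∧⊄⇒⊇ p⊆q p⊄q) p⊆q))

x∈p─q⇒x∉q : ∀ {n} {p q : Subset n} {x} → x ∈ p ─ q → x ∉ q
x∈p─q⇒x∉q {p = _ Vec.∷ _} {inside Vec.∷ _} ()        here
x∈p─q⇒x∉q {p = _ Vec.∷ _} {_      Vec.∷ _} (there h) (there k) = x∈p─q⇒x∉q h k

Laminar : ∀ {n} → Subset n → Subset n → Set
Laminar C D = (C ⊆ D ⊎ D ⊆ C) ⊎ Disjoint C D

IsParent : ∀ {n} → Family n → Subset n → Subset n → Set
IsParent M B P = M P × B ⊂ P × (∀ C → M C → B ⊂ C → C ⊆ P → C ≡ P)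

module _ {n : ℕ} where

  disjoint⁺ : ∀ {p q : Subset n} → (∀ {x} → x ∈ p → x ∉ q) → Disjoint p q
  disjoint⁺ {p} {q} f (x , x∈p∩q) = let (x∈p , x∈q) = x∈p∩q⁻ p q x∈p∩q in f x∈p x∈q

  disjoint⁻ : ∀ {p q : Subset n} {x} → Disjoint p q → x ∈ p → x ∉ q
  disjoint⁻ d x∈p x∈q = d (_ , x∈p∩q⁺ (x∈p , x∈q))

  Disjoint-sym : ∀ {p q : Subset n} → Disjoint p q → Disjoint q p
  Disjoint-sym d = disjoint⁺ λ x∈q x∈p → disjoint⁻ d x∈p x∈q

  Disjoint-antimono : ∀ {p q r s : Subset n} → r ⊆ p → s ⊆ q → Disjoint p q → Disjoint r s
  Disjoint-antimono r⊆p s⊆q d = disjoint⁺ λ x∈r x∈s → disjoint⁻ d (r⊆p x∈r) (s⊆q x∈s)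

  Nonempty-⊆⇒¬Disjoint : ∀ {p q r : Subset n} → Nonempty r → r ⊆ p → r ⊆ q → ¬ Disjoint p q
  Nonempty-⊆⇒¬Disjoint (x , x∈r) r⊆p r⊆q d = disjoint⁻ d (r⊆p x∈r) (r⊆q x∈r)

  Disjoint⇒≢ : ∀ {p q r : Subset n} → Nonempty r → r ⊆ p → Disjoint r q → q ≢ p
  Disjoint⇒≢ ne r⊆p d refl = Nonempty-⊆⇒¬Disjoint ne ⊆-refl r⊆p d

  Laminar-sym : ∀ {C D : Subset n} → Laminar C D → Laminar D C
  Laminar-sym (inj₁ (inj₁ C⊆D)) = inj₁ (inj₂ C⊆D)
  Laminar-sym (inj₁ (inj₂ D⊆C)) = inj₁ (inj₁ D⊆C)
  Laminar-sym (inj₂ d)          = inj₂ (Disjoint-sym d)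

  laminar? : (C D : Subset n) → Dec (Laminar C D)
  laminar? C D = ((C ⊆? D) ⊎-dec (D ⊆? C)) ⊎-dec ¬? (nonempty? (C ∩ D))

  ⋃⊆⁺ : ∀ {r : Subset n} {Ds} → All (_⊆ r) Ds → ⋃ Ds ⊆ r
  ⋃⊆⁺ []             = ⊥-elim ∘ ∉⊥
  ⋃⊆⁺ (D⊆r ∷ Ds⊆r) = ∪-least D⊆r (⋃⊆⁺ Ds⊆r)

  ⋃⊆⁻ : ∀ {r : Subset n} Ds → ⋃ Ds ⊆ r → All (_⊆ r) Ds
  ⋃⊆⁻ []       _  = []
  ⋃⊆⁻ (D ∷ Ds) ⊆r = ⊆r ∘ p⊆p∪q _ ∷ ⋃⊆⁻ Ds (⊆r ∘ q⊆p∪q D _)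

  Disjoint-⋃⁺ : ∀ {p : Subset n} {Ds} → All (Disjoint p) Ds → Disjoint p (⋃ Ds)
  Disjoint-⋃⁺ []         = λ (_ , x∈p∩∅) → ∉⊥ (proj₂ (x∈p∩q⁻ _ ∅ x∈p∩∅))
  Disjoint-⋃⁺ (d ∷ ds) = disjoint⁺ λ x∈p x∈D∪ →
    [ disjoint⁻ d x∈p , disjoint⁻ (Disjoint-⋃⁺ ds) x∈p ]′ (x∈p∪q⁻ _ _ x∈D∪)

  Disjoint-⋃⁻ : ∀ {p : Subset n} Ds → Disjoint p (⋃ Ds) → All (Disjoint p) Ds
  Disjoint-⋃⁻ Ds d = All.map (λ {D} (D⊆⋃ : D ⊆ ⋃ Ds) → Disjoint-antimono ⊆-refl D⊆⋃ d) (⋃⊆⁻ Ds ⊆-refl)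

  ∪-⋃-filter⊈ : ∀ (A : Subset n) Ds → A ∪ ⋃ Ds ≡ A ∪ ⋃ (filter (λ D → ¬? (D ⊆? A)) Ds)
  ∪-⋃-filter⊈ A []       = refl
  ∪-⋃-filter⊈ A (D ∷ Ds) with D ⊆? A
  ... | yes D⊆A = trans (∪-absorbʳ-∪ D⊆A) (∪-⋃-filter⊈ A Ds)
  ... | no  _   = begin
    A ∪ (D ∪ ⋃ Ds)  ≡⟨ ∪-swap A D _ ⟩
    D ∪ (A ∪ ⋃ Ds)  ≡⟨ cong (D ∪_) (∪-⋃-filter⊈ A Ds) ⟩
    D ∪ (A ∪ _)     ≡⟨ ∪-swap D A _ ⟩
    A ∪ (D ∪ _)     ∎
    where open ≡-Reasoning

  IsMaximal : (Subset n → Set) → Subset n → Set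
  IsMaximal Q Y = Q Y × (∀ Z → Q Z → Y ⊆ Z → Z ≡ Y)

  ¬¬-maximal-above : ∀ (Q : Subset n → Set) {X} → Q X → ¬ ¬ (∃ λ Y → X ⊆ Y × IsMaximal Q Y)
  ¬¬-maximal-above Q {X} qX = search qX ⊆-refl (<-wellFounded (n ∸ ∣ X ∣))
    where
    search : ∀ {Y} → Q Y → X ⊆ Y → Acc _<_ (n ∸ ∣ Y ∣) → ¬ ¬ (∃ λ Y → X ⊆ Y × IsMaximal Q Y)
    search {Y} qY X⊆Y (acc rec) k = k (Y , X⊆Y , qY , maximal)
      where
      maximal : ∀ Z → Q Z → Y ⊆ Z → Z ≡ Y
      maximal Z qZ Y⊆Z with Y ⊂? Z
      ... | no  Y⊄Z = ⊆-antisym (⊆∧⊄⇒⊇ Y⊆Z Y⊄Z) Y⊆Z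
      ... | yes Y⊂Z = ⊥-elim (search qZ (⊆-trans X⊆Y Y⊆Z)
                                (rec (∸-monoʳ-< (p⊂q⇒∣p∣<∣q∣ Y⊂Z) (∣p∣≤n Z))) k)

  extract : ∀ (M : Subset n → Set) {C} → Nonempty C → ∀ {Cs} →
    All (λ D → M D ⊎ D ≡ C) Cs → AllPairs Disjoint Cs →
    All M Cs ⊎ ∃ λ Ds → All M Ds × AllPairs Disjoint (C ∷ Ds) × ⋃ Cs ≡ C ∪ ⋃ Ds ×
                        length Cs ≡ suc (length Ds)
  extract M neC {[]} [] [] = inj₁ []
  extract M {C} neC {X ∷ Cs} (inj₁ mX ∷ tags) (dX ∷ pCs) with extract M neC tags pCs
  ... | inj₁ mCs = inj₁ (mX ∷ mCs)
  ... | inj₂ (Ds , mDs , dC ∷ pDs , eq , len) =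
    inj₂ (X ∷ Ds , mX ∷ mDs , (Disjoint-sym (All.head dX′) ∷ dC) ∷ All.tail dX′ ∷ pDs ,
          trans (cong (X ∪_) eq) (∪-swap X C _) , cong suc len)
    where
    dX′ : All (Disjoint X) (C ∷ Ds)
    dX′ = Disjoint-⋃⁻ (C ∷ Ds) (subst (Disjoint X) eq (Disjoint-⋃⁺ dX))
  extract M {C} neC {_ ∷ Cs} (inj₂ refl ∷ tags) (dC ∷ pCs) with extract M neC tags pCs
  ... | inj₁ mCs = inj₂ (Cs , mCs , dC ∷ pCs , refl , refl)
  ... | inj₂ (_ , _ , _ , eq , _) =
    ⊥-elim (Nonempty-⊆⇒¬Disjoint neC ⊆-refl (λ x∈C → subst (_ ∈_) (sym eq) (p⊆p∪q _ x∈C))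
                                  (Disjoint-⋃⁺ dC))

module BuildingSet {n} {ℬ : Family n} (bs : IsBuildingSet ℬ) where
  open IsBuildingSet bs

  ∪-block : ∀ {C D x} → ℬ C → ℬ D → x ∈ C → x ∈ D → ℬ (C ∪ D)
  ∪-block bC bD x∈C x∈D = union _ _ bC bD (_ , x∈p∩q⁺ (x∈C , x∈D))

  Inκ⇒⊆ : ∀ {U C D x} → Inκ ℬ U C → ℬ D → D ⊆ U → x ∈ C → x ∈ D → D ⊆ C
  Inκ⇒⊆ {C = C} {D} (bC , C⊆U , maxC) bD D⊆U x∈C x∈D y∈D = subst (_ ∈_) C∪D≡C (q⊆p∪q C D y∈D)
    where
    C∪D≡C : C ∪ D ≡ C
    C∪D≡C = maxC (C ∪ D) (∪-block bC bD x∈C x∈D) (∪-least C⊆U D⊆U) (p⊆p∪q D)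

  κ-disjoint : ∀ {U C D} → Inκ ℬ U C → Inκ ℬ U D → C ≢ D → Disjoint C D
  κ-disjoint κC@(bC , C⊆U , _) κD@(bD , D⊆U , _) C≢D = disjoint⁺ λ x∈C x∈D →
    C≢D (⊆-antisym (Inκ⇒⊆ κD bC C⊆U x∈D x∈C) (Inκ⇒⊆ κC bD D⊆U x∈C x∈D))

  ¬¬-Inκ-above : ∀ {U X} → ℬ X → X ⊆ U → ¬ ¬ (∃ λ Y → X ⊆ Y × Inκ ℬ U Y)
  ¬¬-Inκ-above bX X⊆U k = ¬¬-maximal-above (λ Y → ℬ Y × Y ⊆ _) (bX , X⊆U)
    λ (Y , X⊆Y , (bY , Y⊆U) , maxY) →
      k (Y , X⊆Y , bY , Y⊆U , λ Z bZ Z⊆U Y⊆Z → maxY Z (bZ , Z⊆U) Y⊆Z)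

module Nested {n} {ℬ : Family n} (bs : IsBuildingSet ℬ) {M : Family n} (N : IsNested ℬ M) where
  open IsBuildingSet bs using (nonempty)
  open IsNested N
  open BuildingSet bs

  relative-position : ∀ {A C D} → M A → C ⊆ A → M D → C ⊆ D ⊎ Disjoint C D ⊎ D ⊆ A
  relative-position mA C⊆A mD with laminar _ _ mD mA
  ... | inj₁ (inj₁ D⊆A) = inj₂ (inj₂ D⊆A)
  ... | inj₁ (inj₂ A⊆D) = inj₁ (⊆-trans C⊆A A⊆D)
  ... | inj₂ d          = inj₂ (inj₁ (Disjoint-antimono C⊆A ⊆-refl (Disjoint-sym d)))

  no-disjoint-extension : ∀ {A Es} → M A → All M Es → AllPairs Disjoint (A ∷ Es) →
    ℬ (⋃ (A ∷ Es)) → Es ≡ []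
  no-disjoint-extension mA []          _    _  = refl
  no-disjoint-extension mA mEs@(_ ∷ _) pAEs bU =
    ⊥-elim (noUnion _ (s≤s (s≤s z≤n)) (mA ∷ mEs) pAEs bU)

  -- Members of M glued to a part C of A by a block are swallowed by A: those not inside A
  -- would be disjoint from A, and gluing them to A contradicts nestedness.
  absorbed : ∀ {A C Ds} → M A → Nonempty C → C ⊆ A → All M Ds → AllPairs Disjoint (C ∷ Ds) →
    ℬ (⋃ (C ∷ Ds)) → All (_⊆ A) Ds
  absorbed {A} {C} {Ds} mA neC@(x , x∈C) C⊆A mDs (dCDs ∷ pDs) bU = ⋃⊆⁻ Ds ⋃Ds⊆A
    where
    ⊈A? : Decidable (λ D → ¬ D ⊆ A)
    ⊈A? D = ¬? (D ⊆? A)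

    Es : List (Subset n)
    Es = filter ⊈A? Ds

    ⊆-or-disjoint : ∀ {D} → M D × Disjoint C D → D ⊆ A ⊎ Disjoint A D
    ⊆-or-disjoint (mD , dCD) with laminar _ _ mD mA
    ... | inj₁ (inj₁ D⊆A) = inj₁ D⊆A
    ... | inj₁ (inj₂ A⊆D) = ⊥-elim (Nonempty-⊆⇒¬Disjoint neC ⊆-refl (A⊆D ∘ C⊆A) dCD)
    ... | inj₂ d          = inj₂ (Disjoint-sym d)

    dAEs : All (Disjoint A) Es
    dAEs = All.zipWith (λ (pos , D⊈A) → [ ⊥-elim ∘ D⊈A , id ]′ pos)
                       ( All.filter⁺ ⊈A? (All.map ⊆-or-disjoint (All.zip (mDs , dCDs)))
                       , All.all-filter ⊈A? Ds)

    bA : ℬ (A ∪ ⋃ Ds)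
    bA = subst ℬ (∪-absorbʳ-∪ C⊆A) (∪-block (sub A mA) bU (C⊆A x∈C) (p⊆p∪q _ x∈C))

    Es≡[] : Es ≡ []
    Es≡[] = no-disjoint-extension mA (All.filter⁺ ⊈A? mDs) (dAEs ∷ AllPairs.filter⁺ ⊈A? pDs)
                                  (subst ℬ (∪-⋃-filter⊈ A Ds) bA)

    A∪⋃Ds≡A : A ∪ ⋃ Ds ≡ A
    A∪⋃Ds≡A = begin
      A ∪ ⋃ Ds  ≡⟨ ∪-⋃-filter⊈ A Ds ⟩
      A ∪ ⋃ Es  ≡⟨ cong (λ Es → A ∪ ⋃ Es) Es≡[] ⟩
      A ∪ ∅     ≡⟨ ∪-identityʳ A ⟩
      A         ∎
      where open ≡-Reasoning

    ⋃Ds⊆A : ⋃ Ds ⊆ A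
    ⋃Ds⊆A y∈⋃Ds = subst (_ ∈_) A∪⋃Ds≡A (q⊆p∪q A _ y∈⋃Ds)

  Free : Subset n → Fin n → Set
  Free P r = r ∈ P × (∀ E → M E → E ⊂ P → r ∉ E)

  Free⇒⊆- : ∀ {P r} → Free P r → ∀ E → M E → E ⊂ P → E ⊆ P - r
  Free⇒⊆- (_ , avoid) E mE E⊂P x∈E =
    x∈p∧x≢y⇒x∈p-y (proj₁ E⊂P x∈E) λ { refl → avoid E mE E⊂P x∈E }

  below-parent : ∀ {B P X} → M B → IsParent M B P → M X → X ⊂ P → X ⊆ B ⊎ Disjoint X B
  below-parent {B} {P} {X} mB (_ , _ , minimal) mX X⊂P with laminar X B mX mB
  ... | inj₁ (inj₁ X⊆B) = inj₁ X⊆B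
  ... | inj₂ d          = inj₂ d
  ... | inj₁ (inj₂ B⊆X) with B ⊂? X
  ...   | yes B⊂X = ⊥-elim (⊂-irref (minimal _ mX B⊂X (proj₁ X⊂P)) X⊂P)
  ...   | no  B⊄X = inj₁ (⊆∧⊄⇒⊇ B⊆X B⊄X)

  -- The maximal proper members of M below P are pairwise disjoint; a maximal list of them
  -- would cover P if no point of P were free, contradicting nestedness.
  ¬¬-free : ∀ {P} → M P → ¬ ¬ ∃ (Free P)
  ¬¬-free {P} mP no-free = ¬¬-maximal-above Cover ([] , [] , [] , refl)
    λ { (_ , _ , (Es , mEs , pEs , refl) , maxX) →
          ⋃-proper≢P mEs pEs (⊆-antisym (⋃⊆⁺ (All.map (proj₁ ∘ proj₂ ∘ proj₁) mEs))
                                          (covers mEs pEs maxX)) }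
    where
    Proper : Subset n → Set
    Proper E = M E × E ⊂ P

    Cover : Subset n → Set
    Cover X = ∃ λ Es → All (IsMaximal Proper) Es × AllPairs Disjoint Es × ⋃ Es ≡ X

    separated-disjoint : ∀ {E F x} → IsMaximal Proper E → IsMaximal Proper F →
      x ∈ E → x ∉ F → Disjoint E F
    separated-disjoint ((mE , E⊂P) , maxE) ((mF , F⊂P) , maxF) x∈E x∉F with laminar _ _ mE mF
    ... | inj₁ (inj₁ E⊆F) = ⊥-elim (x∉F (subst (_ ∈_) (sym (maxE _ (mF , F⊂P) E⊆F)) x∈E))
    ... | inj₁ (inj₂ F⊆E) = ⊥-elim (x∉F (subst (_ ∈_) (maxF _ (mE , E⊂P) F⊆E) x∈E))
    ... | inj₂ d          = d

    ⋃-proper≢P : ∀ {Es} → All (IsMaximal Proper) Es → AllPairs Disjoint Es → ⋃ Es ≢ P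
    ⋃-proper≢P [] _ ∅≡P with nonempty P (sub P mP)
    ... | x , x∈P = ∉⊥ (subst (x ∈_) (sym ∅≡P) x∈P)
    ⋃-proper≢P (((_ , _ , x , x∈P , x∉E) , _) ∷ []) _ E∪∅≡P =
      [ x∉E , ∉⊥ ]′ (x∈p∪q⁻ _ _ (subst (x ∈_) (sym E∪∅≡P) x∈P))
    ⋃-proper≢P mEs@(_ ∷ _ ∷ _) pEs ⋃Es≡P =
      noUnion _ (s≤s (s≤s z≤n)) (All.map (proj₁ ∘ proj₁) mEs) pEs (subst ℬ (sym ⋃Es≡P) (sub P mP))

    covers : ∀ {Es} → All (IsMaximal Proper) Es → AllPairs Disjoint Es →
      (∀ Z → Cover Z → ⋃ Es ⊆ Z → Z ≡ ⋃ Es) → P ⊆ ⋃ Es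
    covers {Es} mEs pEs maxX {p} p∈P with p ∈? ⋃ Es
    ... | yes p∈X = p∈X
    ... | no  p∉X = ⊥-elim (no-free (p , p∈P , λ E mE E⊂P p∈E →
            ¬¬-maximal-above Proper (mE , E⊂P) λ (F , E⊆F , maxF) → enlarge maxF (E⊆F p∈E)))
      where
      enlarge : ∀ {F} → IsMaximal Proper F → p ∈ F → ⊥
      enlarge {F} maxF p∈F = p∉X (subst (p ∈_) (maxX (F ∪ ⋃ Es) cover (q⊆p∪q F _)) (p⊆p∪q _ p∈F))
        where
        cover : Cover (F ∪ ⋃ Es)
        cover = F ∷ Es , maxF ∷ mEs , dFEs ∷ pEs , refl
          where
          dFEs : All (Disjoint F) Es
          dFEs = All.zipWith (λ (maxE , E⊆X) → separated-disjoint maxF maxE p∈F λ p∈E → p∉X (E⊆X p∈E))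
                             (mEs , ⋃⊆⁻ Es ⊆-refl)

module MaximalNested {n} {ℬ : Family n} (bs : IsBuildingSet ℬ) {M : Family n}
  (MN : IsMaximalNested ℬ M) where
  open IsBuildingSet bs using (nonempty)
  open BuildingSet bs
  open IsMaximalNested MN public
  open IsNested nested public
  open Nested bs nested public

  extension : ∀ {C} → ℬ C → (∀ D → M D → Laminar C D) →
    (∀ Ds → All M Ds → AllPairs Disjoint (C ∷ Ds) → length Ds ≥ 1 → ¬ ℬ (⋃ (C ∷ Ds))) → M C
  extension {C} bC lam noUnion-C = maximal M+ M+-nested (λ _ → inj₁) C (inj₂ refl)
    where
    M+ : Family n
    M+ D = M D ⊎ D ≡ C

    M+-laminar : ∀ D E → M+ D → M+ E → Laminar D E
    M+-laminar D E (inj₁ mD)   (inj₁ mE)   = laminar D E mD mE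
    M+-laminar D _ (inj₁ mD)   (inj₂ refl) = Laminar-sym (lam D mD)
    M+-laminar _ E (inj₂ refl) (inj₁ mE)   = lam E mE
    M+-laminar _ _ (inj₂ refl) (inj₂ refl) = inj₁ (inj₁ ⊆-refl)

    M+-noUnion : ∀ Cs → length Cs ≥ 2 → All M+ Cs → AllPairs Disjoint Cs → ¬ ℬ (⋃ Cs)
    M+-noUnion Cs len mCs pCs bU with extract M (nonempty C bC) mCs pCs
    ... | inj₁ mCs′ = noUnion Cs len mCs′ pCs bU
    ... | inj₂ (Ds , mDs , pCDs , eq , len′) =
      noUnion-C Ds mDs pCDs (≤-pred (subst (2 ≤_) len′ len)) (subst ℬ eq bU)

    M+-nested : IsNested ℬ M+
    M+-nested = record
      { sub       = λ { D (inj₁ mD) → sub D mD ; _ (inj₂ refl) → bC }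
      ; laminar   = M+-laminar
      ; noUnion   = M+-noUnion
      ; maxBlocks = λ D maxD → inj₁ (maxBlocks D maxD)
      }

  stable : ∀ {C} → ℬ C → ¬ ¬ M C → M C
  stable {C} bC ¬¬mC = extension bC
    (λ D mD → decidable-stable (laminar? C D) λ ¬lam → ¬¬mC λ mC → ¬lam (laminar C D mC mD))
    (λ Ds mDs pCDs len bU → ¬¬mC λ mC → noUnion (C ∷ Ds) (s≤s len) (mC ∷ mDs) pCDs bU)

  κ-member : ∀ {U C} → Inκ ℬ U C →
    (∀ D → M D → C ⊆ D ⊎ Disjoint C D ⊎ D ⊆ U) →
    (∀ Ds → All M Ds → AllPairs Disjoint (C ∷ Ds) → ℬ (⋃ (C ∷ Ds)) → All (_⊆ U) Ds) →
    M C
  κ-member {U} {C} κC@(bC , C⊆U , maxC) position confined = extension bC lam no-union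
    where
    lam : ∀ D → M D → Laminar C D
    lam D mD with position D mD
    ... | inj₁ C⊆D        = inj₁ (inj₁ C⊆D)
    ... | inj₂ (inj₁ d)   = inj₂ d
    ... | inj₂ (inj₂ D⊆U) with nonempty? (C ∩ D)
    ...   | no  d            = inj₂ d
    ...   | yes (_ , x∈C∩D) with x∈p∩q⁻ C D x∈C∩D
    ...     | x∈C , x∈D = inj₁ (inj₂ (Inκ⇒⊆ κC (sub D mD) D⊆U x∈C x∈D))

    no-union : ∀ Ds → All M Ds → AllPairs Disjoint (C ∷ Ds) → length Ds ≥ 1 → ¬ ℬ (⋃ (C ∷ Ds))
    no-union (D ∷ Ds) mDs@(mD ∷ _) pCDs@((dCD ∷ _) ∷ _) _ bU =
      Nonempty-⊆⇒¬Disjoint (nonempty D (sub D mD)) D⊆C ⊆-refl dCD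
      where
      ⋃≡C : ⋃ (C ∷ D ∷ Ds) ≡ C
      ⋃≡C = maxC _ bU (∪-least C⊆U (⋃⊆⁺ (confined (D ∷ Ds) mDs pCDs bU))) (p⊆p∪q _)
      D⊆C : D ⊆ C
      D⊆C x∈D = subst (_ ∈_) ⋃≡C (q⊆p∪q C _ (p⊆p∪q _ x∈D))

  κ-member-below : ∀ {P S X} → M P → (∀ E → M E → E ⊂ P → E ⊆ P ─ S) → Inκ ℬ (P ─ S) X → M X
  κ-member-below {P} {S} {X} mP proper⊆ κX@(bX , X⊆P─S , _) = κ-member κX position confined
    where
    X⊆P : X ⊆ P
    X⊆P = p─q⊆p P S ∘ X⊆P─S

    position : ∀ D → M D → X ⊆ D ⊎ Disjoint X D ⊎ D ⊆ P ─ S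
    position D mD with relative-position mP X⊆P mD
    ... | inj₁ X⊆D        = inj₁ X⊆D
    ... | inj₂ (inj₁ d)   = inj₂ (inj₁ d)
    ... | inj₂ (inj₂ D⊆P) with D ⊂? P
    ...   | yes D⊂P = inj₂ (inj₂ (proper⊆ D mD D⊂P))
    ...   | no  D⊄P = inj₁ (⊆∧⊄⇒⊇ D⊆P D⊄P ∘ X⊆P)

    confined : ∀ Ds → All M Ds → AllPairs Disjoint (X ∷ Ds) → ℬ (⋃ (X ∷ Ds)) → All (_⊆ P ─ S) Ds
    confined Ds mDs pXDs@(dXDs ∷ _) bU with nonempty X bX
    ... | neX@(x , x∈X) = All.zipWith proper (All.zip (mDs , dXDs) , absorbed mP neX X⊆P mDs pXDs bU)
      where
      proper : ∀ {D} → (M D × Disjoint X D) × D ⊆ P → D ⊆ P ─ S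
      proper ((mD , dXD) , D⊆P) = proper⊆ _ mD (D⊆P , x , X⊆P x∈X , disjoint⁻ dXD x∈X)

  ¬¬-child-κ : ∀ {B P r} → M B → IsParent M B P → Free P r → r ∉ B → ¬ ¬ Inκ ℬ (P - r) B
  ¬¬-child-κ {B} {P} {r} mB (mP , B⊂P , minimal) free r∉B k =
    ¬¬-Inκ-above (sub B mB) B⊆P-r λ { (X , B⊆X , κX@(_ , X⊆P-r , _)) → grow X B⊆X κX X⊆P-r }
    where
    B⊆P-r : B ⊆ P - r
    B⊆P-r x∈B = x∈p∧x≢y⇒x∈p-y (proj₁ B⊂P x∈B) λ { refl → r∉B x∈B }

    grow : ∀ X → B ⊆ X → Inκ ℬ (P - r) X → X ⊆ P - r → ⊥
    grow X B⊆X κX X⊆P-r with B ⊂? X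
    ... | no  B⊄X = k (subst (Inκ ℬ (P - r)) (⊆-antisym (⊆∧⊄⇒⊇ B⊆X B⊄X) B⊆X) κX)
    ... | yes B⊂X = x∈p─q⇒x∉q (X⊆P-r r∈X) (x∈⁅x⁆ r)
      where
      r∈X : r ∈ X
      r∈X = subst (r ∈_) (sym (minimal X (κ-member-below mP (Free⇒⊆- free) κX) B⊂X
                                        (p─q⊆p P _ ∘ X⊆P-r)))
                  (proj₁ free)

module Exchange {n} {ℬ 𝒩 𝒩′ : Family n} {B B′ : Subset n} (bs : IsBuildingSet ℬ)
  (MN : IsMaximalNested ℬ 𝒩) (MN′ : IsMaximalNested ℬ 𝒩′) (nB : 𝒩 B) (nB′ : 𝒩′ B′) (B≢B′ : B ≢ B′)
  (swap  : ∀ C → 𝒩 C × C ≢ B → 𝒩′ C × C ≢ B′)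
  (swap′ : ∀ C → 𝒩′ C × C ≢ B′ → 𝒩 C × C ≢ B) where
  open IsBuildingSet bs using (nonempty)
  open BuildingSet bs
  open MaximalNested bs MN public
  module N′ = MaximalNested bs MN′

  𝒩⇒𝒩′ : ∀ {C} → 𝒩 C → C ≢ B → 𝒩′ C
  𝒩⇒𝒩′ mC C≢B = proj₁ (swap _ (mC , C≢B))

  𝒩′⇒𝒩 : ∀ {C} → 𝒩′ C → C ≢ B′ → 𝒩 C
  𝒩′⇒𝒩 mC C≢B′ = proj₁ (swap′ _ (mC , C≢B′))

  B′∉𝒩 : ¬ 𝒩 B′
  B′∉𝒩 mB′ = proj₂ (swap B′ (mB′ , ≢-sym B≢B′)) refl

  neB : Nonempty B
  neB = nonempty B (sub B nB)

  neB′ : Nonempty B′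
  neB′ = nonempty B′ (N′.sub B′ nB′)

  -- B′ is compatible with every member of 𝒩 except possibly B, so adding it to 𝒩 can only
  -- fail through B.
  B′-incompatible : Laminar B′ B →
    (∀ Gs → All (λ G → 𝒩 G × 𝒩′ G) Gs → AllPairs Disjoint (B′ ∷ B ∷ Gs) →
      ¬ ℬ (⋃ (B′ ∷ B ∷ Gs))) →
    ⊥
  B′-incompatible lam no-union = B′∉𝒩 (extension (N′.sub B′ nB′) lam′ no-union′)
    where
    lam′ : ∀ D → 𝒩 D → Laminar B′ D
    lam′ D mD with D ≟ B
    ... | yes refl = lam
    ... | no  D≢B  = N′.laminar B′ D nB′ (𝒩⇒𝒩′ mD D≢B)

    tag : ∀ {D} → 𝒩 D → (𝒩 D × 𝒩′ D) ⊎ D ≡ B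
    tag {D} mD with D ≟ B
    ... | yes D≡B = inj₂ D≡B
    ... | no  D≢B = inj₁ (mD , 𝒩⇒𝒩′ mD D≢B)

    no-union′ : ∀ Ds → All 𝒩 Ds → AllPairs Disjoint (B′ ∷ Ds) → length Ds ≥ 1 → ¬ ℬ (⋃ (B′ ∷ Ds))
    no-union′ Ds mDs (dB′Ds ∷ pDs) len bU with extract _ neB (All.map tag mDs) pDs
    ... | inj₁ both = N′.noUnion (B′ ∷ Ds) (s≤s len) (nB′ ∷ All.map proj₂ both) (dB′Ds ∷ pDs) bU
    ... | inj₂ (Gs , both , pBGs , eq , _) =
      no-union Gs both (Disjoint-⋃⁻ (B ∷ Gs) (subst (Disjoint B′) eq (Disjoint-⋃⁺ dB′Ds)) ∷ pBGs)
               (subst (λ Z → ℬ (B′ ∪ Z)) eq bU)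

  B⊈B′ : ¬ B ⊆ B′
  B⊈B′ B⊆B′ = B′-incompatible (inj₁ (inj₂ B⊆B′))
    λ { _ _ ((dB′B ∷ _) ∷ _) _ → Nonempty-⊆⇒¬Disjoint neB B⊆B′ ⊆-refl dB′B }

  ⊇B′⇒¬Disjoint-B : ∀ {D} → 𝒩 D → B′ ⊆ D → ¬ Disjoint D B
  ⊇B′⇒¬Disjoint-B {D} mD B′⊆D dDB = B′-incompatible (inj₂ (Disjoint-antimono B′⊆D ⊆-refl dDB))
    λ { Gs both pB′BGs bU → case-absorbed (absorbed mD neB′ B′⊆D (nB ∷ All.map proj₁ both) pB′BGs bU) }
    where
    case-absorbed : ∀ {Gs} → All (_⊆ D) (B ∷ Gs) → ⊥
    case-absorbed (B⊆D ∷ _) = Nonempty-⊆⇒¬Disjoint neB B⊆D ⊆-refl dDB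

  κ[B∩B′]⊆𝒩 : ∀ {C} → Inκ ℬ (B ∩ B′) C → 𝒩 C
  κ[B∩B′]⊆𝒩 {C} κC@(bC , C⊆B∩B′ , _) = κ-member κC position confined
    where
    C⊆B : C ⊆ B
    C⊆B = p∩q⊆p B B′ ∘ C⊆B∩B′

    C⊆B′ : C ⊆ B′
    C⊆B′ = p∩q⊆q B B′ ∘ C⊆B∩B′

    position : ∀ D → 𝒩 D → C ⊆ D ⊎ Disjoint C D ⊎ D ⊆ B ∩ B′
    position D mD with relative-position nB C⊆B mD
    ... | inj₁ C⊆D        = inj₁ C⊆D
    ... | inj₂ (inj₁ d)   = inj₂ (inj₁ d)
    ... | inj₂ (inj₂ D⊆B) with D ≟ B
    ...   | yes refl = inj₁ C⊆B
    ...   | no  D≢B with N′.relative-position nB′ C⊆B′ (𝒩⇒𝒩′ mD D≢B)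
    ...     | inj₁ C⊆D         = inj₁ C⊆D
    ...     | inj₂ (inj₁ d)    = inj₂ (inj₁ d)
    ...     | inj₂ (inj₂ D⊆B′) = inj₂ (inj₂ (⊆∩⁺ D⊆B D⊆B′))

    confined : ∀ Ds → All 𝒩 Ds → AllPairs Disjoint (C ∷ Ds) → ℬ (⋃ (C ∷ Ds)) → All (_⊆ B ∩ B′) Ds
    confined Ds mDs pCDs@(dCDs ∷ _) bU =
      All.zipWith ⊆∩ (absorbed nB neC C⊆B mDs pCDs bU , N′.absorbed nB′ neC C⊆B′ mDs′ pCDs bU)
      where
      neC : Nonempty C
      neC = nonempty C bC
      mDs′ : All 𝒩′ Ds
      mDs′ = All.zipWith (λ (mD , dCD) → 𝒩⇒𝒩′ mD (Disjoint⇒≢ neC C⊆B dCD)) (mDs , dCDs)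
      ⊆∩ : ∀ {D} → D ⊆ B × D ⊆ B′ → D ⊆ B ∩ B′
      ⊆∩ (D⊆B , D⊆B′) = ⊆∩⁺ D⊆B D⊆B′

module ExchangeWithParent {n} {ℬ 𝒩 𝒩′ : Family n} {B B′ P : Subset n} (bs : IsBuildingSet ℬ)
  (MN : IsMaximalNested ℬ 𝒩) (MN′ : IsMaximalNested ℬ 𝒩′) (nB : 𝒩 B) (nB′ : 𝒩′ B′) (B≢B′ : B ≢ B′)
  (swap  : ∀ C → 𝒩 C × C ≢ B → 𝒩′ C × C ≢ B′)
  (swap′ : ∀ C → 𝒩′ C × C ≢ B′ → 𝒩 C × C ≢ B)
  (parent : IsParent 𝒩 B P) where
  open IsBuildingSet bs using (nonempty)
  open Exchange bs MN MN′ nB nB′ B≢B′ swap swap′ public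
  module Mirror = Exchange bs MN′ MN nB′ nB (≢-sym B≢B′) swap′ swap

  nP : 𝒩 P
  nP = proj₁ parent

  B⊆P : B ⊆ P
  B⊆P = proj₁ (proj₁ (proj₂ parent))

  nP′ : 𝒩′ P
  nP′ = 𝒩⇒𝒩′ nP λ P≡B → ⊂-irref (sym P≡B) (proj₁ (proj₂ parent))

  B′⊆P : B′ ⊆ P
  B′⊆P with N′.laminar B′ P nB′ nP′
  ... | inj₁ (inj₁ B′⊆P) = B′⊆P
  ... | inj₁ (inj₂ P⊆B′) = ⊥-elim (B⊈B′ (P⊆B′ ∘ B⊆P))
  ... | inj₂ d           = ⊥-elim (Mirror.⊇B′⇒¬Disjoint-B nP′ B⊆P (Disjoint-sym d))

  parent′ : IsParent 𝒩′ B′ P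
  parent′ = nP′ , ⊆∧≢⇒⊂ B′⊆P (λ P≡B′ → B′∉𝒩 (subst 𝒩 P≡B′ nP)) , minimal′
    where
    minimal′ : ∀ C → 𝒩′ C → B′ ⊂ C → C ⊆ P → C ≡ P
    minimal′ C mC′ B′⊂C@(B′⊆C , _) C⊆P = place (laminar C B mC nB)
      where
      mC : 𝒩 C
      mC = 𝒩′⇒𝒩 mC′ λ { refl → ⊂-irref refl B′⊂C }

      place : Laminar C B → C ≡ P
      place (inj₁ (inj₁ C⊆B)) = ⊥-elim (Mirror.B⊈B′ (C⊆B ∘ B′⊆C))
      place (inj₂ d)          = ⊥-elim (⊇B′⇒¬Disjoint-B mC B′⊆C d)
      place (inj₁ (inj₂ B⊆C)) with B ⊂? C
      ... | yes B⊂C = proj₂ (proj₂ parent) C mC B⊂C C⊆P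
      ... | no  B⊄C = ⊥-elim (Mirror.B′∉𝒩 (subst 𝒩′ (⊆-antisym (⊆∧⊄⇒⊇ B⊆C B⊄C) B⊆C) mC′))

  Free⇒Free′ : ∀ {r} → Free P r → r ∉ B′ → N′.Free P r
  Free⇒Free′ {r} (r∈P , avoid) r∉B′ = r∈P , avoid′
    where
    avoid′ : ∀ E → 𝒩′ E → E ⊂ P → r ∉ E
    avoid′ E mE E⊂P with E ≟ B′
    ... | yes refl = r∉B′
    ... | no  E≢B′ = avoid E (𝒩′⇒𝒩 mE E≢B′) E⊂P

  -- If r avoided both, B and B′ would be maximal blocks of P - r, hence disjoint, and every
  -- block glued to B′ through B would stay inside P - r, so B′ could be added to 𝒩.
  free-point-∉B∪B′-impossible : ∀ {r} → Free P r → r ∉ B → r ∉ B′ → ⊥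
  free-point-∉B∪B′-impossible {r} free r∉B r∉B′ =
    ¬¬-child-κ nB parent free r∉B λ κB →
    N′.¬¬-child-κ nB′ parent′ (Free⇒Free′ free r∉B′) r∉B′ λ κB′ →
    B′-incompatible (inj₂ (κ-disjoint κB′ κB (≢-sym B≢B′))) (glue κB κB′)
    where
    open BuildingSet bs using (κ-disjoint)

    glue : Inκ ℬ (P - r) B → Inκ ℬ (P - r) B′ →
      ∀ Gs → All (λ G → 𝒩 G × 𝒩′ G) Gs → AllPairs Disjoint (B′ ∷ B ∷ Gs) → ¬ ℬ (⋃ (B′ ∷ B ∷ Gs))
    glue (_ , B⊆P-r , maxB) (_ , B′⊆P-r , _) Gs both pB′BGs@((dB′B ∷ _) ∷ dBGs ∷ _) bU
      with absorbed nP neB′ B′⊆P (nB ∷ All.map proj₁ both) pB′BGs bU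
    ... | _ ∷ Gs⊆P = Nonempty-⊆⇒¬Disjoint neB′ ⊆-refl B′⊆B dB′B
      where
      x∈B : proj₁ neB ∈ B
      x∈B = proj₂ neB
      Gs⊆P-r : All (_⊆ P - r) Gs
      Gs⊆P-r = All.zipWith below (All.zip (both , dBGs) , Gs⊆P)
        where
        below : ∀ {G} → ((𝒩 G × 𝒩′ G) × Disjoint B G) × G ⊆ P → G ⊆ P - r
        below (((mG , _) , dBG) , G⊆P) = Free⇒⊆- free _ mG (G⊆P , _ , B⊆P x∈B , disjoint⁻ dBG x∈B)
      ⋃≡B : ⋃ (B′ ∷ B ∷ Gs) ≡ B
      ⋃≡B = maxB _ bU (∪-least B′⊆P-r (∪-least B⊆P-r (⋃⊆⁺ Gs⊆P-r))) (q⊆p∪q B′ _ ∘ p⊆p∪q _)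
      B′⊆B : B′ ⊆ B
      B′⊆B x∈B′ = subst (_ ∈_) ⋃≡B (p⊆p∪q _ x∈B′)

  κ[P─B∪B′]⊆𝒩 : ∀ {C} → Inκ ℬ (P ─ (B ∪ B′)) C → 𝒩 C
  κ[P─B∪B′]⊆𝒩 {C} κC@(bC , C⊆ , maxC) = stable bC λ C∉𝒩 → ¬¬-free nP λ (r , free) →
    locate C∉𝒩 r free (r ∈? C)
    where
    open BuildingSet bs using (¬¬-Inκ-above)

    ∉B∪B′ : ∀ {x} → x ∈ C → x ∉ B ∪ B′
    ∉B∪B′ x∈C = x∈p─q⇒x∉q (C⊆ x∈C)

    C⊆P : C ⊆ P
    C⊆P = p─q⊆p P _ ∘ C⊆

    -- If r ∉ C, a maximal block X ⊇ C of P - r is a proper member of 𝒩 and of 𝒩′ below P,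
    -- so it avoids B and B′ and therefore equals C.
    locate : ¬ 𝒩 C → ∀ r → Free P r → Dec (r ∈ C) → ⊥
    locate _ r free (yes r∈C) =
      free-point-∉B∪B′-impossible free (∉B∪B′ r∈C ∘ p⊆p∪q B′) (∉B∪B′ r∈C ∘ q⊆p∪q B B′)
    locate C∉𝒩 r free (no r∉C) =
      ¬¬-Inκ-above bC (λ x∈C → x∈p∧x≢y⇒x∈p-y (C⊆P x∈C) λ { refl → r∉C x∈C })
        λ { (X , C⊆X , κX@(bX , X⊆P-r , _)) → C∉𝒩 (subst 𝒩 (X≡C X C⊆X κX) (mX κX)) }
      where
      mX : ∀ {X} → Inκ ℬ (P - r) X → 𝒩 X
      mX = κ-member-below nP (Free⇒⊆- free)

      X≡C : ∀ X → C ⊆ X → Inκ ℬ (P - r) X → X ≡ C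
      X≡C X C⊆X κX@(bX , X⊆P-r , _) = maxC X bX X⊆ C⊆X
        where
        X⊂P : X ⊂ P
        X⊂P = p─q⊆p P _ ∘ X⊆P-r , r , proj₁ free , λ r∈X → x∈p─q⇒x∉q (X⊆P-r r∈X) (x∈⁅x⁆ r)

        c∈C : proj₁ (nonempty C bC) ∈ C
        c∈C = proj₂ (nonempty C bC)

        avoid : ∀ {A} → X ⊆ A ⊎ Disjoint X A → A ⊆ B ∪ B′ → Disjoint X A
        avoid (inj₂ d)   _  = d
        avoid (inj₁ X⊆A) A⊆ = ⊥-elim (∉B∪B′ c∈C (A⊆ (X⊆A (C⊆X c∈C))))

        dXB : Disjoint X B
        dXB = avoid (below-parent nB parent (mX κX) X⊂P) (p⊆p∪q B′)

        dXB′ : Disjoint X B′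
        dXB′ = avoid (N′.below-parent nB′ parent′ mX′ X⊂P) (q⊆p∪q B B′)
          where
          mX′ : 𝒩′ X
          mX′ = 𝒩⇒𝒩′ (mX κX) (≢-sym (Disjoint⇒≢ (nonempty X bX) ⊆-refl dXB))

        X⊆ : X ⊆ P ─ (B ∪ B′)
        X⊆ x∈X = x∈p∧x∉q⇒x∈p─q (p─q⊆p P _ (X⊆P-r x∈X))
          λ x∈B∪B′ → [ disjoint⁻ dXB x∈X , disjoint⁻ dXB′ x∈X ]′ (x∈p∪q⁻ B B′ x∈B∪B′)

  κ[B∩B′]⊆𝒩∩𝒩′ : ∀ {C} → Inκ ℬ (B ∩ B′) C → 𝒩 C × 𝒩′ C
  κ[B∩B′]⊆𝒩∩𝒩′ {C} κC = κ[B∩B′]⊆𝒩 κC , Mirror.κ[B∩B′]⊆𝒩 (subst (λ U → Inκ ℬ U C) (∩-comm B B′) κC)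

  κ[P─B∪B′]⊆𝒩∩𝒩′ : ∀ {C} → Inκ ℬ (P ─ (B ∪ B′)) C → 𝒩 C × 𝒩′ C
  κ[P─B∪B′]⊆𝒩∩𝒩′ {C} κC@(_ , C⊆ , _) = mC , 𝒩⇒𝒩′ mC λ { refl → x∈p─q⇒x∉q (C⊆ x∈B) (p⊆p∪q B′ x∈B) }
    where
    mC : 𝒩 C
    mC = κ[P─B∪B′]⊆𝒩 κC

    x∈B : proj₁ neB ∈ B
    x∈B = proj₂ neB

proposition3p17 : ∀ {n : ℕ} (ℬ 𝒩 𝒩′ : Family n) (B B′ P : Subset n) →
    IsBuildingSet ℬ →
    IsMaximalNested ℬ 𝒩 → IsMaximalNested ℬ 𝒩′ →
    𝒩 B → 𝒩′ B′ → B ≢ B′ →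
    (∀ C → 𝒩 C × C ≢ B → 𝒩′ C × C ≢ B′) →
    (∀ C → 𝒩′ C × C ≢ B′ → 𝒩 C × C ≢ B) →
    𝒩 P → B ⊂ P → (∀ C → 𝒩 C → B ⊂ C → C ⊆ P → C ≡ P) →
    (∀ C → Inκ ℬ (B ∩ B′) C → 𝒩 C × 𝒩′ C) ×
    (∀ C → Inκ ℬ (P ─ (B ∪ B′)) C → 𝒩 C × 𝒩′ C)
proposition3p17 ℬ 𝒩 𝒩′ B B′ P bs MN MN′ nB nB′ B≢B′ swap swap′ nP B⊂P minimal =
  (λ _ → κ[B∩B′]⊆𝒩∩𝒩′) , (λ _ → κ[P─B∪B′]⊆𝒩∩𝒩′)
  where open ExchangeWithParent bs MN MN′ nB nB′ B≢B′ swap swap′ (nP , B⊂P , minimal)
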